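{- For $k\ge1$, $$W_{111\text{ - }1}(x;k)=\sum_{j=1}^k\frac{(k-j)!\binom{k}{j}\bigl(1+x(1+x)+\delta_{j,1}x^3\bigr)x^{3(k-j)}}{\prod_{i=j}^k\bigl(1-(i-1)x(1+x)\bigr)},$$ where $\delta_{j,1}$ is the Kronecker delta.
   Context: For $k\ge1$ let $[k]=\{1,\dots,k\}$; a $k$-ary word of length $n$ is an element of $[k]^n$. A word $w=w_1\cdots w_n$ contains the vincular pattern $111\text{ - }1$ if there are indices $p$ and $q\ge p+3$ with $w_p=w_{p+1}=w_{p+2}=w_q$; otherwise it avoids it. $a_{111\text{ - }1}(n,k)$ is the number of words in $[k]^n$ avoiding $111\text{ - }1$ (with $a(0,k)=1$), and $W_{111\text{ - }1}(x;k)=\sum_{n\ge0}a_{111\text{ - }1}(n,k)x^n$. -}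

module Defs where

open import Data.Nat as ℕ using (ℕ; zero; suc; _∸_; _<_; _≤_)
import Data.Nat.Properties as ℕP
open import Data.Nat using (_!)
open import Data.Nat.Combinatorics using (_C_)
open import Data.Integer as ℤ using (ℤ; +_)
open import Data.Fin using (Fin; toℕ)
import Data.Fin.Properties as FinP
open import Data.Vec using (Vec; []; _∷_; lookup; head; toList)
open import Data.List as List using (List; []; _∷_; upTo; length; filter; concatMap; map; zipWith)
open import Data.Product using (∃; ∃-syntax; _×_; _,_)
open import Relation.Nullary using (¬_; Dec; ¬?)
open import Relation.Nullary.Decidable using (_×-dec_)
open import Relation.Binary.PropositionalEquality using (_≡_)

-- A k-ary word of length n (letters are Fin k, i.e. [k] shifted by one).
Word : ℕ → ℕ → Set
Word n k = Vec (Fin k) n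

Contains111-1 : ∀ {n k} → Word n k → Set
Contains111-1 {n} w =
  ∃[ p₁ ] ∃[ p₂ ] ∃[ p₃ ] ∃[ q ]
    (toℕ p₂ ≡ suc (toℕ p₁)) × (toℕ p₃ ≡ suc (toℕ p₂)) × (toℕ p₃ < toℕ q) ×
    (lookup w p₁ ≡ lookup w p₂) × (lookup w p₂ ≡ lookup w p₃) × (lookup w p₃ ≡ lookup w q)

contains? : ∀ {n k} (w : Word n k) → Dec (Contains111-1 w)
contains? w =
  FinP.any? λ p₁ → FinP.any? λ p₂ → FinP.any? λ p₃ → FinP.any? λ q →
    (toℕ p₂ ℕP.≟ suc (toℕ p₁)) ×-dec (toℕ p₃ ℕP.≟ suc (toℕ p₂)) ×-dec
    (toℕ p₃ ℕP.<? toℕ q) ×-dec (lookup w p₁ FinP.≟ lookup w p₂) ×-dec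
    (lookup w p₂ FinP.≟ lookup w p₃) ×-dec (lookup w p₃ FinP.≟ lookup w q)

allWords : (n k : ℕ) → List (Word n k)
allWords zero    k = [] ∷ []
allWords (suc n) k = concatMap (λ a → map (a ∷_) (allWords n k)) (List.allFin k)

a111-1 : ℕ → ℕ → ℕ
a111-1 n k = length (filter (λ w → ¬? (contains? w)) (allWords n k))

sumℤ : List ℤ → ℤ
sumℤ = List.foldr ℤ._+_ (+ 0)

PS : Set
PS = ℕ → ℤ

const : ℤ → PS
const c zero    = c
const c (suc _) = + 0

X : PS
X 1 = + 1
X _ = + 0

_⊕_ : PS → PS → PS
(f ⊕ g) n = f n ℤ.+ g n

_⊖_ : PS → PS → PS
(f ⊖ g) n = f n ℤ.- g n

_⊛_ : PS → PS → PS
(f ⊛ g) n = sumℤ (map (λ i → f i ℤ.* g (n ∸ i)) (upTo (suc n)))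

infixl 6 _⊕_ _⊖_
infixl 7 _⊛_

_^ˢ_ : PS → ℕ → PS
f ^ˢ zero  = const (+ 1)
f ^ˢ suc m = f ⊛ (f ^ˢ m)

sumˢ : List PS → PS
sumˢ = List.foldr _⊕_ (const (+ 0))

prodˢ : List PS → PS
prodˢ = List.foldr _⊛_ (const (+ 1))

-- Multiplicative inverse of a power series f with constant term 1:
-- g 0 = 1,  g (n+1) = - Σ_{i=1}^{n+1} f i * g (n+1-i).
-- invVec f n = (g n ∷ g (n-1) ∷ … ∷ g 0).
invVec : PS → (n : ℕ) → Vec ℤ (suc n)
invVec f zero    = + 1 ∷ []
invVec f (suc n) =
  let gs = invVec f n in
  ℤ.- sumℤ (zipWith ℤ._*_ (map (λ i → f (suc i)) (upTo (suc n))) (toList gs)) ∷ gs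

-- 1/f, valid (and only used) when f 0 = 1
inv₁ : PS → PS
inv₁ f n = head (invVec f n)

-- [j .. k] (empty if j > k)
range : ℕ → ℕ → List ℕ
range j k = map (j ℕ.+_) (upTo (suc k ∸ j))

δ₁ : ℕ → ℤ
δ₁ 1 = + 1
δ₁ _ = + 0

summand : ℕ → ℕ → PS
summand k j =
  const (+ ((k ∸ j) ! ℕ.* (k C j)))
  ⊛ (const (+ 1) ⊕ X ⊛ (const (+ 1) ⊕ X) ⊕ const (δ₁ j) ⊛ X ^ˢ 3)
  ⊛ X ^ˢ (3 ℕ.* (k ∸ j))
  ⊛ inv₁ (prodˢ (map (λ i → const (+ 1) ⊖ const (+ (i ∸ 1)) ⊛ X ⊛ (const (+ 1) ⊕ X)) (range j k)))

RHS : ℕ → PS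
RHS k = sumˢ (map (summand k) (range 1 k))

W111-1 : ℕ → PS
W111-1 k n = + a111-1 n k

-- Once a letter has occurred three times in a row it can never occur again: call it dead. Read a
-- word from the left; whether a prefix extends to an avoiding word, and in how many ways, depends
-- only on the number i of live letters and on the phase of the current run of a live letter (idle,
-- one copy, two copies). This gives three linear recurrences in n; in generating functions,
-- eliminating the single and double phases leaves, for the idle series N_i,
--   N_{i+1} = ((i+1) x³ N_i + 1 + x(1+x)) / (1 - i x (1+x)),   N_0 = 1.
-- The right-hand side obeys the same recurrence in k: going from k to k+1 multiplies every summand
-- j ≤ k by (k+1) x³ / (1 - k x (1+x)) and adds the summand j = k+1; at k = 1 the Kronecker delta
-- supplies the term x³ that comes from N_0.
module Submission where

open import Defs
open import Data.Nat using (ℕ; _≤_)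
open import Relation.Binary.PropositionalEquality using (_≡_)

open import Data.Nat using (zero; suc; _∸_; _!; s≤s; z≤n)
import Data.Nat as Nat
import Data.Nat.Properties as ℕP
open import Data.Nat.Combinatorics using (_C_; nCn≡1; nCk≡n!/k![n-k]!; k![n∸k]!∣n!)
open import Data.Nat.DivMod using (_/_; m*[n/m]≡n)
open import Data.Nat.ListAction using (sum)
import Data.Integer as Int
import Data.Integer.Properties as ℤP
open import Data.Bool using (Bool; true; false; if_then_else_; _∨_)
import Data.Bool.Properties as BoolP
open import Data.Fin using (Fin; zero; suc)
open import Data.Fin.Properties using (_≟_)
open import Data.Vec as Vec using (Vec; []; _∷_; lookup)
open import Data.List as List
  using (List; []; _∷_; _++_; _∷ʳ_; [_]; length; filter; map; concatMap; upTo; applyUpTo; tabulate; allFin)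
import Data.List.Properties as LP
open import Data.List.Relation.Unary.All as All using (All; []; _∷_)
open import Data.List.Relation.Unary.All.Properties using (map⁺; all-upTo)
open import Data.Product using (∃-syntax; _×_; _,_; proj₁; proj₂)
open import Data.Sum using (_⊎_; inj₁; inj₂)
open import Data.Empty using (⊥)
open import Data.Unit using (⊤; tt)
open import Data.Maybe using (Maybe; just; nothing)
open import Function using (_∘_; id)
open import Level using (0ℓ)
open import Relation.Nullary using (¬_; yes; no; does; contradiction)
open import Relation.Nullary.Decidable using (dec-false)
open import Relation.Unary using (Pred; Decidable)
open import Relation.Binary.PropositionalEquality using (refl; sym; trans; cong; cong₂; module ≡-Reasoning)
open import Algebra.Bundles using (CommutativeRing)
open import Algebra.Structures using (IsCommutativeRing)
open import Algebra.Solver.Ring.AlmostCommutativeRing using (fromCommutativeRing; _-Raw-AlmostCommutative⟶_)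
import Algebra.Solver.Ring
import Relation.Binary.Reasoning.Setoid
import Data.Integer.Tactic.RingSolver as ℤSolver
import Data.Nat.Tactic.RingSolver as ℕSolver
open import Algebra.Properties.Monoid.Sum ℕP.+-0-monoid using (sum-cong-≗) renaming (sum to ∑)

module Lists where

  open Nat using (_+_)
  open ≡-Reasoning

  zipWith-applyUpTo : ∀ {A B C : Set} (_∙_ : A → B → C) (a : ℕ → A) (b : ℕ → B) m →
    List.zipWith _∙_ (applyUpTo a m) (applyUpTo b m) ≡ applyUpTo (λ i → a i ∙ b i) m
  zipWith-applyUpTo _∙_ a b zero    = refl
  zipWith-applyUpTo _∙_ a b (suc m) = cong (a 0 ∙ b 0 ∷_) (zipWith-applyUpTo _∙_ (a ∘ suc) (b ∘ suc) m)

  length-filter-cong : ∀ {A : Set} {P Q : Pred A 0ℓ} (P? : Decidable P) (Q? : Decidable Q) →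
    (∀ x → P x → Q x) → (∀ x → Q x → P x) → ∀ xs → length (filter P? xs) ≡ length (filter Q? xs)
  length-filter-cong P? Q? P⇒Q Q⇒P [] = refl
  length-filter-cong P? Q? P⇒Q Q⇒P (x ∷ xs) with P? x | Q? x
  ... | yes _  | yes _  = cong suc (length-filter-cong P? Q? P⇒Q Q⇒P xs)
  ... | yes px | no ¬qx = contradiction (P⇒Q x px) ¬qx
  ... | no ¬px | yes qx = contradiction (Q⇒P x qx) ¬px
  ... | no _   | no _   = length-filter-cong P? Q? P⇒Q Q⇒P xs

  length-filter-map : ∀ {A B : Set} {P : Pred B 0ℓ} (P? : Decidable P) (f : A → B) xs →
    length (filter P? (map f xs)) ≡ length (filter (P? ∘ f) xs)
  length-filter-map P? f [] = refl
  length-filter-map P? f (x ∷ xs) with P? (f x)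
  ... | yes _ = cong suc (length-filter-map P? f xs)
  ... | no _  = length-filter-map P? f xs

  length-filter-concatMap : ∀ {A B : Set} {P : Pred B 0ℓ} (P? : Decidable P) (f : A → List B) xs →
    length (filter P? (concatMap f xs)) ≡ sum (map (length ∘ filter P? ∘ f) xs)
  length-filter-concatMap P? f [] = refl
  length-filter-concatMap P? f (x ∷ xs) = begin
    length (filter P? (f x ++ concatMap f xs))
      ≡⟨ cong length (LP.filter-++ P? (f x) (concatMap f xs)) ⟩
    length (filter P? (f x) ++ filter P? (concatMap f xs))
      ≡⟨ LP.length-++ (filter P? (f x)) ⟩
    length (filter P? (f x)) + length (filter P? (concatMap f xs))
      ≡⟨ cong (length (filter P? (f x)) +_) (length-filter-concatMap P? f xs) ⟩
    sum (map (length ∘ filter P? ∘ f) (x ∷ xs))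
      ∎

  sum-tabulate : ∀ {k} (g : Fin k → ℕ) → sum (tabulate g) ≡ ∑ g
  sum-tabulate {zero}  g = refl
  sum-tabulate {suc k} g = cong (g zero +_) (sum-tabulate (g ∘ suc))

  range-∷ʳ : ∀ {j m} → j ≤ suc m → range j (suc m) ≡ range j m ∷ʳ suc m
  range-∷ʳ {j} {m} j≤1+m = begin
    map (j +_) (upTo (suc (suc m) ∸ j))             ≡⟨ cong (map (j +_) ∘ upTo) (ℕP.+-∸-assoc 1 j≤1+m) ⟩
    map (j +_) (upTo (suc (suc m ∸ j)))             ≡⟨ cong (map (j +_)) (LP.upTo-∷ʳ (suc m ∸ j)) ⟨
    map (j +_) (upTo (suc m ∸ j) ∷ʳ (suc m ∸ j))    ≡⟨ LP.map-++ (j +_) (upTo (suc m ∸ j)) [ suc m ∸ j ] ⟩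
    range j m ∷ʳ (j + (suc m ∸ j))                  ≡⟨ cong (range j m ∷ʳ_) (ℕP.m+[n∸m]≡n j≤1+m) ⟩
    range j m ∷ʳ suc m                              ∎

  range-diagonal : ∀ k → range k k ≡ [ k ]
  range-diagonal k = trans (cong (map (k +_) ∘ upTo) (ℕP.m+n∸n≡m 1 k)) (cong [_] (ℕP.+-identityʳ k))

  range-1-bounded : ∀ m → All (_≤ m) (range 1 m)
  range-1-bounded m = map⁺ (all-upTo m)

module PowerSeries where

  open import Data.Integer using (+_; _+_; _*_; -_)
  open Lists using (zipWith-applyUpTo)

  infix 4 _≈_
  _≈_ : PS → PS → Set
  f ≈ g = ∀ n → f n ≡ g n

  0ˢ 1ˢ : PS
  0ˢ = const (+ 0)
  1ˢ = const (+ 1)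

  -ˢ_ : PS → PS
  (-ˢ f) n = - f n

  shift : PS → PS
  shift f n = f (suc n)

  ⊛-at-0 : ∀ f g → (f ⊛ g) 0 ≡ f 0 * g 0
  ⊛-at-0 f g = ℤP.+-identityʳ (f 0 * g 0)

  ⊛-at-suc : ∀ f g n → (f ⊛ g) (suc n) ≡ f 0 * g (suc n) + (shift f ⊛ g) n
  ⊛-at-suc f g n = cong (λ l → f 0 * g (suc n) + sumℤ l)
    (trans (LP.map-applyUpTo suc (λ i → f i * g (suc n ∸ i)) (suc n))
           (sym (LP.map-upTo (λ i → f (suc i) * g (n ∸ i)) (suc n))))

  open ≡-Reasoning

  ⊛-at-sucʳ : ∀ f g n → (f ⊛ g) (suc n) ≡ (f ⊛ shift g) n + f (suc n) * g 0
  ⊛-at-sucʳ f g zero = begin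
    (f ⊛ g) 1                       ≡⟨ ⊛-at-suc f g 0 ⟩
    f 0 * g 1 + (shift f ⊛ g) 0     ≡⟨ cong₂ _+_ (sym (⊛-at-0 f (shift g))) (⊛-at-0 (shift f) g) ⟩
    (f ⊛ shift g) 0 + f 1 * g 0     ∎
  ⊛-at-sucʳ f g (suc n) = begin
    (f ⊛ g) (suc (suc n))
      ≡⟨ ⊛-at-suc f g (suc n) ⟩
    f 0 * g (suc (suc n)) + (shift f ⊛ g) (suc n)
      ≡⟨ cong (λ z → f 0 * g (suc (suc n)) + z) (⊛-at-sucʳ (shift f) g n) ⟩
    f 0 * g (suc (suc n)) + ((shift f ⊛ shift g) n + f (suc (suc n)) * g 0)
      ≡⟨ ℤP.+-assoc (f 0 * g (suc (suc n))) _ _ ⟨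
    f 0 * g (suc (suc n)) + (shift f ⊛ shift g) n + f (suc (suc n)) * g 0
      ≡⟨ cong (_+ (f (suc (suc n)) * g 0)) (⊛-at-suc f (shift g) n) ⟨
    (f ⊛ shift g) (suc n) + f (suc (suc n)) * g 0
      ∎

  ⊛-cong : ∀ {f f′ g g′} → f ≈ f′ → g ≈ g′ → f ⊛ g ≈ f′ ⊛ g′
  ⊛-cong {f} {f′} {g} {g′} f≈f′ g≈g′ zero = begin
    (f ⊛ g) 0      ≡⟨ ⊛-at-0 f g ⟩
    f 0 * g 0      ≡⟨ cong₂ _*_ (f≈f′ 0) (g≈g′ 0) ⟩
    f′ 0 * g′ 0    ≡⟨ ⊛-at-0 f′ g′ ⟨
    (f′ ⊛ g′) 0    ∎
  ⊛-cong {f} {f′} {g} {g′} f≈f′ g≈g′ (suc n) = begin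
    (f ⊛ g) (suc n)                        ≡⟨ ⊛-at-suc f g n ⟩
    f 0 * g (suc n) + (shift f ⊛ g) n      ≡⟨ cong₂ _+_ (cong₂ _*_ (f≈f′ 0) (g≈g′ (suc n)))
                                                        (⊛-cong (f≈f′ ∘ suc) g≈g′ n) ⟩
    f′ 0 * g′ (suc n) + (shift f′ ⊛ g′) n  ≡⟨ ⊛-at-suc f′ g′ n ⟨
    (f′ ⊛ g′) (suc n)                      ∎

  ⊛-comm : ∀ f g → f ⊛ g ≈ g ⊛ f
  ⊛-comm f g zero = begin
    (f ⊛ g) 0    ≡⟨ ⊛-at-0 f g ⟩
    f 0 * g 0    ≡⟨ ℤP.*-comm (f 0) (g 0) ⟩
    g 0 * f 0    ≡⟨ ⊛-at-0 g f ⟨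
    (g ⊛ f) 0    ∎
  ⊛-comm f g (suc n) = begin
    (f ⊛ g) (suc n)                      ≡⟨ ⊛-at-suc f g n ⟩
    f 0 * g (suc n) + (shift f ⊛ g) n    ≡⟨ cong₂ _+_ (ℤP.*-comm (f 0) (g (suc n))) (⊛-comm (shift f) g n) ⟩
    g (suc n) * f 0 + (g ⊛ shift f) n    ≡⟨ ℤP.+-comm (g (suc n) * f 0) _ ⟩
    (g ⊛ shift f) n + g (suc n) * f 0    ≡⟨ ⊛-at-sucʳ g f n ⟨
    (g ⊛ f) (suc n)                      ∎

  ⊛-distribˡ-⊕ : ∀ f g h → f ⊛ (g ⊕ h) ≈ f ⊛ g ⊕ f ⊛ h
  ⊛-distribˡ-⊕ f g h zero = begin
    (f ⊛ (g ⊕ h)) 0          ≡⟨ ⊛-at-0 f (g ⊕ h) ⟩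
    f 0 * (g 0 + h 0)        ≡⟨ ℤP.*-distribˡ-+ (f 0) (g 0) (h 0) ⟩
    f 0 * g 0 + f 0 * h 0    ≡⟨ cong₂ _+_ (⊛-at-0 f g) (⊛-at-0 f h) ⟨
    (f ⊛ g ⊕ f ⊛ h) 0        ∎
  ⊛-distribˡ-⊕ f g h (suc n) = begin
    (f ⊛ (g ⊕ h)) (suc n)
      ≡⟨ ⊛-at-suc f (g ⊕ h) n ⟩
    f 0 * (g (suc n) + h (suc n)) + (shift f ⊛ (g ⊕ h)) n
      ≡⟨ cong (λ z → f 0 * (g (suc n) + h (suc n)) + z) (⊛-distribˡ-⊕ (shift f) g h n) ⟩
    f 0 * (g (suc n) + h (suc n)) + ((shift f ⊛ g) n + (shift f ⊛ h) n)
      ≡⟨ regroup (f 0) (g (suc n)) (h (suc n)) _ _ ⟩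
    (f 0 * g (suc n) + (shift f ⊛ g) n) + (f 0 * h (suc n) + (shift f ⊛ h) n)
      ≡⟨ cong₂ _+_ (⊛-at-suc f g n) (⊛-at-suc f h n) ⟨
    (f ⊛ g ⊕ f ⊛ h) (suc n)
      ∎
    where
    regroup : ∀ a b c d e → a * (b + c) + (d + e) ≡ (a * b + d) + (a * c + e)
    regroup = ℤSolver.solve-∀

  ⊛-distribʳ-⊕ : ∀ f g h → (g ⊕ h) ⊛ f ≈ g ⊛ f ⊕ h ⊛ f
  ⊛-distribʳ-⊕ f g h n = begin
    ((g ⊕ h) ⊛ f) n          ≡⟨ ⊛-comm (g ⊕ h) f n ⟩
    (f ⊛ (g ⊕ h)) n          ≡⟨ ⊛-distribˡ-⊕ f g h n ⟩
    (f ⊛ g) n + (f ⊛ h) n    ≡⟨ cong₂ _+_ (⊛-comm f g n) (⊛-comm f h n) ⟩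
    (g ⊛ f ⊕ h ⊛ f) n        ∎

  ⊛-zeroˡ : ∀ f g → (∀ n → f n ≡ + 0) → ∀ n → (f ⊛ g) n ≡ + 0
  ⊛-zeroˡ f g f≡0 zero = trans (⊛-at-0 f g) (cong (_* g 0) (f≡0 0))
  ⊛-zeroˡ f g f≡0 (suc n) = begin
    (f ⊛ g) (suc n)                      ≡⟨ ⊛-at-suc f g n ⟩
    f 0 * g (suc n) + (shift f ⊛ g) n
      ≡⟨ cong₂ _+_ (cong (_* g (suc n)) (f≡0 0)) (⊛-zeroˡ (shift f) g (f≡0 ∘ suc) n) ⟩
    + 0                                  ∎

  const-⊛ : ∀ c f n → (const c ⊛ f) n ≡ c * f n
  const-⊛ c f zero = ⊛-at-0 (const c) f
  const-⊛ c f (suc n) = begin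
    (const c ⊛ f) (suc n)                          ≡⟨ ⊛-at-suc (const c) f n ⟩
    c * f (suc n) + (shift (const c) ⊛ f) n
      ≡⟨ cong (λ z → c * f (suc n) + z) (⊛-zeroˡ (shift (const c)) f (λ _ → refl) n) ⟩
    c * f (suc n) + + 0                            ≡⟨ ℤP.+-identityʳ (c * f (suc n)) ⟩
    c * f (suc n)                                  ∎

  X⊛-at-0 : ∀ f → (X ⊛ f) 0 ≡ + 0
  X⊛-at-0 f = ⊛-at-0 X f

  X⊛-at-suc : ∀ f n → (X ⊛ f) (suc n) ≡ f n
  X⊛-at-suc f n = begin
    (X ⊛ f) (suc n)                       ≡⟨ ⊛-at-suc X f n ⟩
    + 0 * f (suc n) + (shift X ⊛ f) n     ≡⟨ cong (_+ (shift X ⊛ f) n) (ℤP.*-zeroˡ (f (suc n))) ⟩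
    + 0 + (shift X ⊛ f) n                 ≡⟨ ℤP.+-identityˡ ((shift X ⊛ f) n) ⟩
    (shift X ⊛ f) n                       ≡⟨ ⊛-cong {g = f} {g′ = f} shiftX≈1 (λ _ → refl) n ⟩
    (1ˢ ⊛ f) n                            ≡⟨ const-⊛ (+ 1) f n ⟩
    + 1 * f n                             ≡⟨ ℤP.*-identityˡ (f n) ⟩
    f n                                   ∎
    where
    shiftX≈1 : shift X ≈ 1ˢ
    shiftX≈1 zero    = refl
    shiftX≈1 (suc _) = refl

  ⊛-assoc : ∀ f g h → (f ⊛ g) ⊛ h ≈ f ⊛ (g ⊛ h)
  ⊛-assoc f g h zero = begin
    ((f ⊛ g) ⊛ h) 0        ≡⟨ ⊛-at-0 (f ⊛ g) h ⟩
    (f ⊛ g) 0 * h 0        ≡⟨ cong (_* h 0) (⊛-at-0 f g) ⟩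
    f 0 * g 0 * h 0        ≡⟨ ℤP.*-assoc (f 0) (g 0) (h 0) ⟩
    f 0 * (g 0 * h 0)      ≡⟨ cong (f 0 *_) (⊛-at-0 g h) ⟨
    f 0 * (g ⊛ h) 0        ≡⟨ ⊛-at-0 f (g ⊛ h) ⟨
    (f ⊛ (g ⊛ h)) 0        ∎
  ⊛-assoc f g h (suc n) = begin
    ((f ⊛ g) ⊛ h) (suc n)
      ≡⟨ ⊛-at-suc (f ⊛ g) h n ⟩
    (f ⊛ g) 0 * h (suc n) + (shift (f ⊛ g) ⊛ h) n
      ≡⟨ cong₂ _+_ (cong (_* h (suc n)) (⊛-at-0 f g)) (⊛-cong {g = h} {g′ = h} shift-⊛ (λ _ → refl) n) ⟩
    f 0 * g 0 * h (suc n) + ((const (f 0) ⊛ shift g ⊕ shift f ⊛ g) ⊛ h) n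
      ≡⟨ cong (λ z → f 0 * g 0 * h (suc n) + z) (⊛-distribʳ-⊕ h (const (f 0) ⊛ shift g) (shift f ⊛ g) n) ⟩
    f 0 * g 0 * h (suc n) + (((const (f 0) ⊛ shift g) ⊛ h) n + ((shift f ⊛ g) ⊛ h) n)
      ≡⟨ cong (λ z → f 0 * g 0 * h (suc n) + (z + ((shift f ⊛ g) ⊛ h) n))
              (trans (⊛-assoc (const (f 0)) (shift g) h n) (const-⊛ (f 0) (shift g ⊛ h) n)) ⟩
    f 0 * g 0 * h (suc n) + (f 0 * (shift g ⊛ h) n + ((shift f ⊛ g) ⊛ h) n)
      ≡⟨ cong (λ z → f 0 * g 0 * h (suc n) + (f 0 * (shift g ⊛ h) n + z)) (⊛-assoc (shift f) g h n) ⟩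
    f 0 * g 0 * h (suc n) + (f 0 * (shift g ⊛ h) n + (shift f ⊛ (g ⊛ h)) n)
      ≡⟨ regroup (f 0) (g 0) (h (suc n)) _ _ ⟩
    f 0 * (g 0 * h (suc n) + (shift g ⊛ h) n) + (shift f ⊛ (g ⊛ h)) n
      ≡⟨ cong (λ z → f 0 * z + (shift f ⊛ (g ⊛ h)) n) (⊛-at-suc g h n) ⟨
    f 0 * (g ⊛ h) (suc n) + (shift f ⊛ (g ⊛ h)) n
      ≡⟨ ⊛-at-suc f (g ⊛ h) n ⟨
    (f ⊛ (g ⊛ h)) (suc n)
      ∎
    where
    shift-⊛ : shift (f ⊛ g) ≈ const (f 0) ⊛ shift g ⊕ shift f ⊛ g
    shift-⊛ m = trans (⊛-at-suc f g m) (cong (_+ (shift f ⊛ g) m) (sym (const-⊛ (f 0) (shift g) m)))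
    regroup : ∀ a b c d e → a * b * c + (a * d + e) ≡ a * (b * c + d) + e
    regroup = ℤSolver.solve-∀

  const-0 : ∀ n → 0ˢ n ≡ + 0
  const-0 zero    = refl
  const-0 (suc n) = refl

  1ˢ-⊛ : ∀ f → 1ˢ ⊛ f ≈ f
  1ˢ-⊛ f n = trans (const-⊛ (+ 1) f n) (ℤP.*-identityˡ (f n))

  isCommutativeRing : IsCommutativeRing _≈_ _⊕_ _⊛_ -ˢ_ 0ˢ 1ˢ
  isCommutativeRing = record
    { isRing = record
      { +-isAbelianGroup = record
        { isGroup = record
          { isMonoid = record
            { isSemigroup = record
              { isMagma = record
                { isEquivalence = record
                  { refl  = λ _ → refl
                  ; sym   = λ f≈g n → sym (f≈g n)
                  ; trans = λ f≈g g≈h n → trans (f≈g n) (g≈h n)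
                  }
                ; ∙-cong = λ f≈f′ g≈g′ n → cong₂ _+_ (f≈f′ n) (g≈g′ n)
                }
              ; assoc = λ f g h n → ℤP.+-assoc (f n) (g n) (h n)
              }
            ; identity = (λ f n → trans (cong (_+ f n) (const-0 n)) (ℤP.+-identityˡ (f n)))
                       , (λ f n → trans (cong (λ z → f n + z) (const-0 n)) (ℤP.+-identityʳ (f n)))
            }
          ; inverse = (λ f n → trans (ℤP.+-inverseˡ (f n)) (sym (const-0 n)))
                    , (λ f n → trans (ℤP.+-inverseʳ (f n)) (sym (const-0 n)))
          ; ⁻¹-cong = λ f≈g n → cong -_ (f≈g n)
          }
        ; comm = λ f g n → ℤP.+-comm (f n) (g n)
        }
      ; *-cong     = ⊛-cong
      ; *-assoc    = ⊛-assoc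
      ; *-identity = 1ˢ-⊛ , (λ f n → trans (⊛-comm f 1ˢ n) (1ˢ-⊛ f n))
      ; distrib    = ⊛-distribˡ-⊕ , ⊛-distribʳ-⊕
      }
    ; *-comm = ⊛-comm
    }

  commutativeRing : CommutativeRing 0ℓ 0ℓ
  commutativeRing = record { isCommutativeRing = isCommutativeRing }

  open CommutativeRing commutativeRing public
    using ( setoid; +-cong; +-congˡ; +-congʳ; +-comm; +-assoc; *-cong; *-congˡ; *-congʳ
          ; *-identityˡ; *-identityʳ; *-comm; *-assoc; distribˡ; zeroʳ )
    renaming (refl to ≈-refl; sym to ≈-sym; trans to ≈-trans)

  const-homomorphism : CommutativeRing.rawRing ℤP.+-*-commutativeRing
                         -Raw-AlmostCommutative⟶ fromCommutativeRing commutativeRing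
  const-homomorphism = record
    { ⟦_⟧    = const
    ; +-homo = λ a b → λ { zero → refl ; (suc _) → refl }
    ; *-homo = λ a b n → sym (trans (const-⊛ a (const b) n) (const-* a b n))
    ; -‿homo = λ a → λ { zero → refl ; (suc _) → refl }
    ; 0-homo = λ { zero → refl ; (suc _) → refl }
    ; 1-homo = λ { zero → refl ; (suc _) → refl }
    }
    where
    const-* : ∀ a b n → a * const b n ≡ const (a * b) n
    const-* a b zero    = refl
    const-* a b (suc n) = ℤP.*-zeroʳ a

  const-≟ : ∀ a b → Maybe (const a ≈ const b)
  const-≟ a b with a ℤP.≟ b
  ... | yes refl = just (λ _ → refl)
  ... | no _     = nothing

  module Solver = Algebra.Solver.Ring
    (CommutativeRing.rawRing ℤP.+-*-commutativeRing) (fromCommutativeRing commutativeRing)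
    const-homomorphism const-≟

  const-+ : ∀ m n → const (+ (m Nat.+ n)) ≈ const (+ m) ⊕ const (+ n)
  const-+ m n zero    = ℤP.pos-+ m n
  const-+ m n (suc _) = refl

  const-* : ∀ m n → const (+ (m Nat.* n)) ≈ const (+ m) ⊛ const (+ n)
  const-* m n k = trans (cong (λ c → const c k) (ℤP.pos-* m n))
                        (_-Raw-AlmostCommutative⟶_.*-homo const-homomorphism (+ m) (+ n) k)

  toList-invVec : ∀ f n → Vec.toList (invVec f n) ≡ applyUpTo (λ i → inv₁ f (n ∸ i)) (suc n)
  toList-invVec f zero    = refl
  toList-invVec f (suc n) = cong (inv₁ f (suc n) ∷_) (toList-invVec f n)

  inv₁-at-suc : ∀ f n → inv₁ f (suc n) ≡ - (shift f ⊛ inv₁ f) n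
  inv₁-at-suc f n = cong (λ l → - sumℤ l) (begin
    List.zipWith _*_ (map (f ∘ suc) (upTo (suc n))) (Vec.toList (invVec f n))
      ≡⟨ cong₂ (List.zipWith _*_) (LP.map-upTo (f ∘ suc) (suc n)) (toList-invVec f n) ⟩
    List.zipWith _*_ (applyUpTo (f ∘ suc) (suc n)) (applyUpTo (λ i → inv₁ f (n ∸ i)) (suc n))
      ≡⟨ zipWith-applyUpTo _*_ (f ∘ suc) (λ i → inv₁ f (n ∸ i)) (suc n) ⟩
    applyUpTo (λ i → f (suc i) * inv₁ f (n ∸ i)) (suc n)
      ≡⟨ LP.map-upTo (λ i → f (suc i) * inv₁ f (n ∸ i)) (suc n) ⟨
    map (λ i → f (suc i) * inv₁ f (n ∸ i)) (upTo (suc n))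
      ∎)

  inv₁-inverseʳ : ∀ f → f 0 ≡ + 1 → f ⊛ inv₁ f ≈ 1ˢ
  inv₁-inverseʳ f f₀≡1 zero = trans (⊛-at-0 f (inv₁ f)) (cong (_* + 1) f₀≡1)
  inv₁-inverseʳ f f₀≡1 (suc n) = begin
    (f ⊛ inv₁ f) (suc n)        ≡⟨ ⊛-at-suc f (inv₁ f) n ⟩
    f 0 * inv₁ f (suc n) + r    ≡⟨ cong₂ (λ a b → a * b + r) f₀≡1 (inv₁-at-suc f n) ⟩
    + 1 * - r + r               ≡⟨ cong (_+ r) (ℤP.*-identityˡ (- r)) ⟩
    - r + r                     ≡⟨ ℤP.+-inverseˡ r ⟩
    + 0                         ∎
    where
    r = (shift f ⊛ inv₁ f) n

  unshift : ∀ f g → f 0 ≡ + 1 → shift f ≈ g → f ≈ 1ˢ ⊕ X ⊛ g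
  unshift f g f₀≡1 shift≈g zero    = trans f₀≡1 (cong (λ z → + 1 + z) (X⊛-at-0 g))
  unshift f g f₀≡1 shift≈g (suc n) = trans (shift≈g n) (sym (trans (ℤP.+-identityˡ _) (X⊛-at-suc g n)))

module SeriesAlgebra where

  open import Data.Integer using (+_; _*_)
  open PowerSeries
  open Relation.Binary.Reasoning.Setoid setoid

  sumˢ-∷ʳ : ∀ xs y → sumˢ (xs ∷ʳ y) ≈ sumˢ xs ⊕ y
  sumˢ-∷ʳ []       y = +-comm y 0ˢ
  sumˢ-∷ʳ (x ∷ xs) y = ≈-trans (+-congˡ {x} (sumˢ-∷ʳ xs y)) (≈-sym (+-assoc x (sumˢ xs) y))

  prodˢ-∷ʳ : ∀ xs y → prodˢ (xs ∷ʳ y) ≈ prodˢ xs ⊛ y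
  prodˢ-∷ʳ []       y = *-comm y 1ˢ
  prodˢ-∷ʳ (x ∷ xs) y = ≈-trans (*-congˡ {x} (prodˢ-∷ʳ xs y)) (≈-sym (*-assoc x (prodˢ xs) y))

  sumˢ-map-⊛ : ∀ {A : Set} {f g : A → PS} M {xs} → All (λ x → f x ≈ M ⊛ g x) xs →
    sumˢ (map f xs) ≈ M ⊛ sumˢ (map g xs)
  sumˢ-map-⊛ M []       = ≈-sym (zeroʳ M)
  sumˢ-map-⊛ M (p ∷ ps) = ≈-trans (+-cong p (sumˢ-map-⊛ M ps)) (≈-sym (distribˡ M _ _))

  inv₁-unique : ∀ f g h → f 0 ≡ + 1 → f ⊛ g ≈ h → g ≈ h ⊛ inv₁ f
  inv₁-unique f g h f₀≡1 fg≈h = begin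
    g                    ≈⟨ *-identityʳ g ⟨
    g ⊛ 1ˢ               ≈⟨ *-congˡ {g} (inv₁-inverseʳ f f₀≡1) ⟨
    g ⊛ (f ⊛ inv₁ f)     ≈⟨ *-assoc g f (inv₁ f) ⟨
    (g ⊛ f) ⊛ inv₁ f     ≈⟨ *-congʳ (≈-trans (*-comm g f) fg≈h) ⟩
    h ⊛ inv₁ f           ∎

  ⊛-at-0≡1 : ∀ f g → f 0 ≡ + 1 → g 0 ≡ + 1 → (f ⊛ g) 0 ≡ + 1
  ⊛-at-0≡1 f g f₀≡1 g₀≡1 = trans (⊛-at-0 f g) (cong₂ _*_ f₀≡1 g₀≡1)

  inv₁-cong : ∀ f f′ → f 0 ≡ + 1 → f ≈ f′ → inv₁ f ≈ inv₁ f′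
  inv₁-cong f f′ f₀≡1 f≈f′ =
    ≈-trans (inv₁-unique f′ (inv₁ f) 1ˢ (trans (sym (f≈f′ 0)) f₀≡1)
                         (≈-trans (*-congʳ (≈-sym f≈f′)) (inv₁-inverseʳ f f₀≡1)))
            (*-identityˡ (inv₁ f′))

  inv₁-⊛ : ∀ f g → f 0 ≡ + 1 → g 0 ≡ + 1 → inv₁ (f ⊛ g) ≈ inv₁ f ⊛ inv₁ g
  inv₁-⊛ f g f₀≡1 g₀≡1 =
    ≈-sym (≈-trans (inv₁-unique (f ⊛ g) (inv₁ f ⊛ inv₁ g) 1ˢ (⊛-at-0≡1 f g f₀≡1 g₀≡1) product≈1)
                   (*-identityˡ _))
    where
    open Solver
    product≈1 : (f ⊛ g) ⊛ (inv₁ f ⊛ inv₁ g) ≈ 1ˢ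
    product≈1 =
      ≈-trans (solve 4 (λ a b a′ b′ → (a :* b) :* (a′ :* b′) := (a :* a′) :* (b :* b′)) (λ _ → refl)
                       f g (inv₁ f) (inv₁ g))
      (≈-trans (⊛-cong (inv₁-inverseʳ f f₀≡1) (inv₁-inverseʳ g g₀≡1)) (*-identityˡ 1ˢ))

module Factorials where

  open Nat using (_*_)
  open ℕP using (*-assoc)
  open ≡-Reasoning

  [n∸k]!*nCk*k!≡n! : ∀ {n k} → k ≤ n → (n ∸ k) ! * (n C k) * k ! ≡ n !
  [n∸k]!*nCk*k!≡n! {n} {k} k≤n = begin
    (n ∸ k) ! * (n C k) * k !     ≡⟨ cong (λ c → (n ∸ k) ! * c * k !) (nCk≡n!/k![n-k]! k≤n) ⟩
    (n ∸ k) ! * q * k !           ≡⟨ reorder ((n ∸ k) !) q (k !) ⟩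
    k ! * (n ∸ k) ! * q           ≡⟨ m*[n/m]≡n {{k ℕP.!* (n ∸ k) !≢0}} (k![n∸k]!∣n! k≤n) ⟩
    n !                           ∎
    where
    q = (n ! / (k ! * (n ∸ k) !)) {{k ℕP.!* (n ∸ k) !≢0}}
    reorder : ∀ a b c → a * b * c ≡ c * a * b
    reorder = ℕSolver.solve-∀

  [1+m∸j]![1+m]Cj≡[1+m]*[m∸j]!mCj : ∀ {m j} → j ≤ m →
    (suc m ∸ j) ! * (suc m C j) ≡ suc m * ((m ∸ j) ! * (m C j))
  [1+m∸j]![1+m]Cj≡[1+m]*[m∸j]!mCj {m} {j} j≤m = ℕP.*-cancelʳ-≡ _ _ (j !) {{j ℕP.!≢0}} (begin
    (suc m ∸ j) ! * (suc m C j) * j !        ≡⟨ [n∸k]!*nCk*k!≡n! (ℕP.m≤n⇒m≤1+n j≤m) ⟩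
    suc m !                                  ≡⟨ cong (suc m *_) ([n∸k]!*nCk*k!≡n! j≤m) ⟨
    suc m * ((m ∸ j) ! * (m C j) * j !)      ≡⟨ *-assoc (suc m) ((m ∸ j) ! * (m C j)) (j !) ⟨
    suc m * ((m ∸ j) ! * (m C j)) * j !      ∎)

module Avoidance where

  open Nat using (_+_; _*_)
  open Lists

  private variable
    k n : ℕ

  -- The trailing run of a live letter b, once or twice; idle at the start and after a run of three,
  -- whose letter then becomes dead.
  data Run (k : ℕ) : Set where
    idle          : Run k
    single double : Fin k → Run k

  record State (k : ℕ) : Set where
    constructor state
    field
      dead : Fin k → Bool
      run  : Run k
  open State

  markDead : (Fin k → Bool) → Fin k → Fin k → Bool
  markDead D b a = D a ∨ does (a ≟ b)

  step : State k → Fin k → State k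
  step (state D idle)       a = state D (single a)
  step (state D (single b)) a = if does (a ≟ b) then state D (double b) else state D (single a)
  step (state D (double b)) a = if does (a ≟ b) then state (markDead D b) idle else state D (single a)

  accepts : State k → Vec (Fin k) n → Bool
  accepts s []      = true
  accepts s (a ∷ w) = if dead s a then false else accepts (step s a) w

  Occurs : Fin k → Vec (Fin k) n → Set
  Occurs b w = ∃[ i ] lookup w i ≡ b

  -- Completesⁱ b w: w completes an occurrence of 111-1 begun by i copies of b in front of it.
  Completes¹ Completes² : Fin k → Vec (Fin k) n → Set
  Completes¹ b (x ∷ y ∷ w) = x ≡ b × y ≡ b × Occurs b w
  Completes¹ b _           = ⊥
  Completes² b (x ∷ w) = x ≡ b × Occurs b w
  Completes² b []      = ⊥

  Has111-1 : Vec (Fin k) n → Set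
  Has111-1 []      = ⊥
  Has111-1 (a ∷ w) = Has111-1 w ⊎ Completes¹ a w

  RunSafe : Run k → Vec (Fin k) n → Set
  RunSafe idle       w = ⊤
  RunSafe (single b) w = ¬ Completes¹ b w
  RunSafe (double b) w = ¬ Completes² b w

  Valid : State k → Vec (Fin k) n → Set
  Valid s w = ¬ Has111-1 w × (∀ i → dead s (lookup w i) ≡ false) × RunSafe (run s) w

  has⇒contains : (w : Vec (Fin k) n) → Has111-1 w → Contains111-1 w
  has⇒contains (a ∷ w) (inj₁ h) with has⇒contains w h
  ... | p₁ , p₂ , p₃ , q , e₁ , e₂ , lt , x₁ , x₂ , x₃ =
    suc p₁ , suc p₂ , suc p₃ , suc q , cong suc e₁ , cong suc e₂ , s≤s lt , x₁ , x₂ , x₃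
  has⇒contains (a ∷ x ∷ y ∷ w) (inj₂ (x≡a , y≡a , i , wᵢ≡a)) =
    zero , suc zero , suc (suc zero) , suc (suc (suc i)) , refl , refl , s≤s (s≤s (s≤s z≤n)) ,
    sym x≡a , trans x≡a (sym y≡a) , trans y≡a (sym wᵢ≡a)

  contains⇒has : (w : Vec (Fin k) n) → Contains111-1 w → Has111-1 w
  contains⇒has (a ∷ w) (suc p₁ , suc p₂ , suc p₃ , suc q , e₁ , e₂ , s≤s lt , x₁ , x₂ , x₃) =
    inj₁ (contains⇒has w
      (p₁ , p₂ , p₃ , q , ℕP.suc-injective e₁ , ℕP.suc-injective e₂ , lt , x₁ , x₂ , x₃))
  contains⇒has (a ∷ x ∷ y ∷ w)
               (zero , suc zero , suc (suc zero) , suc (suc (suc q)) , _ , _ , _ , x₁ , x₂ , x₃) =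
    inj₂ (sym x₁ , trans (sym x₂) (sym x₁) , q , trans (sym x₃) (trans (sym x₂) (sym x₁)))
  contains⇒has (a ∷ w) (suc _ , zero , _ , _ , () , _)
  contains⇒has (a ∷ w) (suc _ , suc _ , zero , _ , _ , () , _)
  contains⇒has (a ∷ w) (suc _ , suc _ , suc _ , zero , _ , _ , () , _)
  contains⇒has (a ∷ w) (zero , zero , _ , _ , () , _)
  contains⇒has (a ∷ w) (zero , suc (suc _) , _ , _ , () , _)
  contains⇒has (a ∷ w) (zero , suc zero , zero , _ , _ , () , _)
  contains⇒has (a ∷ w) (zero , suc zero , suc zero , _ , _ , () , _)
  contains⇒has (a ∷ w) (zero , suc zero , suc (suc (suc _)) , _ , _ , () , _)
  contains⇒has (a ∷ w) (zero , suc zero , suc (suc zero) , zero , _ , _ , () , _)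
  contains⇒has (a ∷ w) (zero , suc zero , suc (suc zero) , suc zero , _ , _ , s≤s () , _)
  contains⇒has (a ∷ w) (zero , suc zero , suc (suc zero) , suc (suc zero) , _ , _ , s≤s (s≤s ()) , _)

  completes¹-head : ∀ {a b} (w : Vec (Fin k) n) → Completes¹ b (a ∷ w) → a ≡ b
  completes¹-head (_ ∷ _) (a≡b , _) = a≡b

  completes¹-∷ : ∀ {a b} (w : Vec (Fin k) n) → Completes¹ b (a ∷ w) → Completes² b w
  completes¹-∷ (_ ∷ _) (_ , x≡b , occ) = x≡b , occ

  completes²-∷ : ∀ {b} (w : Vec (Fin k) n) → Completes² b w → Completes¹ b (b ∷ w)
  completes²-∷ (_ ∷ _) (x≡b , occ) = refl , x≡b , occ

  completes¹⇒completes² : ∀ {b} (w : Vec (Fin k) n) → Completes¹ b w → Completes² b w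
  completes¹⇒completes² (_ ∷ _ ∷ _) (x≡b , y≡b , _) = x≡b , zero , y≡b

  completes¹⇒occurs : ∀ {b} (w : Vec (Fin k) n) → Completes¹ b w → Occurs b w
  completes¹⇒occurs (_ ∷ _ ∷ _) (x≡b , _) = zero , x≡b

  runSafe-[] : (r : Run k) → RunSafe r []
  runSafe-[] idle       = tt
  runSafe-[] (single _) = λ ()
  runSafe-[] (double _) = λ ()

  markDead-alive : ∀ (D : Fin k → Bool) {a b} → markDead D b a ≡ false → D a ≡ false × ¬ a ≡ b
  markDead-alive D {a} {b} alive with D a | a ≟ b
  ... | false | no a≢b = refl , a≢b

  ¬has-∷ : ∀ {a} {w : Vec (Fin k) n} → ¬ Has111-1 w → ¬ Completes¹ a w → ¬ Has111-1 (a ∷ w)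
  ¬has-∷ ¬has ¬completes (inj₁ has)       = ¬has has
  ¬has-∷ ¬has ¬completes (inj₂ completes) = ¬completes completes

  alive-∷ : ∀ (D : Fin k → Bool) {a} {w : Vec (Fin k) n} →
    D a ≡ false → (∀ i → D (lookup w i) ≡ false) → ∀ i → D (lookup (a ∷ w) i) ≡ false
  alive-∷ D Da≡false alive zero    = Da≡false
  alive-∷ D Da≡false alive (suc i) = alive i

  valid-∷ : ∀ s a (w : Vec (Fin k) n) → dead s a ≡ false → Valid (step s a) w → Valid s (a ∷ w)
  valid-∷ (state D idle) a w a-alive (¬has , alive , safe) =
    ¬has-∷ ¬has safe , alive-∷ D a-alive alive , tt
  valid-∷ (state D (single b)) a w a-alive (¬has , alive , safe) with a ≟ b
  ... | yes refl =
    ¬has-∷ ¬has (safe ∘ completes¹⇒completes² w) , alive-∷ D a-alive alive , safe ∘ completes¹-∷ w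
  ... | no a≢b = ¬has-∷ ¬has safe , alive-∷ D a-alive alive , a≢b ∘ completes¹-head w
  valid-∷ (state D (double b)) a w a-alive (¬has , alive , safe) with a ≟ b
  ... | yes refl =
    ¬has-∷ ¬has (¬occurs ∘ completes¹⇒occurs w) , alive-∷ D a-alive (proj₁ ∘ markDead-alive D ∘ alive) ,
    ¬occurs ∘ proj₂
    where
    ¬occurs : ¬ Occurs a w
    ¬occurs (i , wᵢ≡a) = proj₂ (markDead-alive D (alive i)) wᵢ≡a
  ... | no a≢b = ¬has-∷ ¬has safe , alive-∷ D a-alive alive , a≢b ∘ proj₁

  valid-∷⁻ : ∀ s a (w : Vec (Fin k) n) → Valid s (a ∷ w) → dead s a ≡ false × Valid (step s a) w
  valid-∷⁻ (state D idle) a w (¬has , alive , _) =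
    alive zero , ¬has ∘ inj₁ , alive ∘ suc , ¬has ∘ inj₂
  valid-∷⁻ (state D (single b)) a w (¬has , alive , safe) with a ≟ b
  ... | yes refl = alive zero , ¬has ∘ inj₁ , alive ∘ suc , safe ∘ completes²-∷ w
  ... | no _     = alive zero , ¬has ∘ inj₁ , alive ∘ suc , ¬has ∘ inj₂
  valid-∷⁻ (state D (double b)) a w (¬has , alive , safe) with a ≟ b
  ... | yes refl = alive zero , ¬has ∘ inj₁ , alive′ , tt
    where
    alive′ : ∀ i → markDead D a (lookup w i) ≡ false
    alive′ i = cong₂ _∨_ (alive (suc i)) (dec-false (lookup w i ≟ a) λ wᵢ≡a → safe (refl , i , wᵢ≡a))
  ... | no _     = alive zero , ¬has ∘ inj₁ , alive ∘ suc , ¬has ∘ inj₂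

  accepts⇒valid : ∀ s (w : Vec (Fin k) n) → accepts s w ≡ true → Valid s w
  accepts⇒valid s []      _   = (λ ()) , (λ ()) , runSafe-[] (run s)
  accepts⇒valid s (a ∷ w) acc with dead s a in a-dead
  accepts⇒valid s (a ∷ w) ()  | true
  ... | false = valid-∷ s a w a-dead (accepts⇒valid (step s a) w acc)

  valid⇒accepts : ∀ s (w : Vec (Fin k) n) → Valid s w → accepts s w ≡ true
  valid⇒accepts s []      _     = refl
  valid⇒accepts s (a ∷ w) valid with valid-∷⁻ s a w valid
  ... | a-alive , valid′ rewrite a-alive = valid⇒accepts (step s a) w valid′

  accepts? : (s : State k) → Decidable (λ (w : Vec (Fin k) n) → accepts s w ≡ true)
  accepts? s w = accepts s w BoolP.≟ true

  accepted : ℕ → State k → ℕ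
  accepted {k} n s = length (filter (accepts? s) (allWords n k))

  initial : State k
  initial = state (λ _ → false) idle

  a111-1≡accepted : ∀ n k → a111-1 n k ≡ accepted n (initial {k})
  a111-1≡accepted n k = length-filter-cong _ (accepts? initial) avoids⇒accepts accepts⇒avoids (allWords n k)
    where
    avoids⇒accepts : ∀ w → ¬ Contains111-1 w → accepts initial w ≡ true
    avoids⇒accepts w ¬contains = valid⇒accepts initial w (¬contains ∘ has⇒contains w , (λ _ → refl) , tt)
    accepts⇒avoids : ∀ w → accepts initial w ≡ true → ¬ Contains111-1 w
    accepts⇒avoids w acc = proj₁ (accepts⇒valid initial w acc) ∘ contains⇒has w

  accepted-∷ : ∀ s a (ws : List (Vec (Fin k) n)) →
    length (filter (accepts? s) (map (a ∷_) ws)) ≡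
    (if dead s a then 0 else length (filter (accepts? (step s a)) ws))
  accepted-∷ s a ws with dead s a in a-dead
  ... | true = trans (length-filter-map (accepts? s) (a ∷_) ws)
                     (cong length (LP.filter-none (accepts? s ∘ (a ∷_)) (All.universal rejected ws)))
    where
    rejected : ∀ w → ¬ accepts s (a ∷ w) ≡ true
    rejected w acc with () ← trans (sym acc) (cong (if_then false else accepts (step s a) w) a-dead)
  ... | false = trans (length-filter-map (accepts? s) (a ∷_) ws)
                      (length-filter-cong _ (accepts? (step s a)) (λ w → trans (sym (unfold w)))
                                          (λ w → trans (unfold w)) ws)
    where
    unfold : ∀ w → accepts s (a ∷ w) ≡ accepts (step s a) w
    unfold w = cong (if_then false else accepts (step s a) w) a-dead

  accepted-suc : ∀ n (s : State k) → accepted (suc n) s ≡ ∑ λ a → if dead s a then 0 else accepted n (step s a)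
  accepted-suc {k} n s = begin
    length (filter (accepts? s) (concatMap extensions (allFin k)))  ≡⟨ length-filter-concatMap (accepts? s) extensions (allFin k) ⟩
    sum (map count (allFin k))                                      ≡⟨ cong sum (LP.map-tabulate id count) ⟩
    sum (tabulate count)                                            ≡⟨ sum-tabulate count ⟩
    ∑ count                                                         ≡⟨ sum-cong-≗ (λ a → accepted-∷ s a (allWords n k)) ⟩
    ∑ (λ a → if dead s a then 0 else accepted n (step s a))         ∎
    where
    open ≡-Reasoning
    extensions : Fin k → List (Vec (Fin k) (suc n))
    extensions a = map (a ∷_) (allWords n k)
    count : Fin k → ℕ
    count a = length (filter (accepts? s) (extensions a))

  live : (Fin k → Bool) → ℕ
  live D = ∑ λ a → if D a then 0 else 1

  ∑-live : ∀ (D : Fin k → Bool) y → (∑ λ a → if D a then 0 else y) ≡ live D * y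
  ∑-live {zero}  D y = refl
  ∑-live {suc k} D y with D zero
  ... | true  = ∑-live (D ∘ suc) y
  ... | false = cong (y +_) (∑-live (D ∘ suc) y)

  ∑-live-split : ∀ (D : Fin k → Bool) b x y → D b ≡ false →
    (∑ λ a → if D a then 0 else if does (a ≟ b) then x else y) ≡ x + live (markDead D b) * y
  ∑-live-split {suc k} D zero x y Db≡false rewrite Db≡false =
    cong (x +_) (trans (∑-live (D ∘ suc) y)
                       (cong (_* y) (sum-cong-≗ λ a → cong (if_then 0 else 1) (sym (BoolP.∨-identityʳ (D (suc a)))))))
  ∑-live-split {suc k} D (suc b) x y Db≡false with D zero
  ... | true  = ∑-live-split (D ∘ suc) b x y Db≡false
  ... | false = trans (cong (y +_) (∑-live-split (D ∘ suc) b x y Db≡false))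
                      (regroup x y (live (markDead (D ∘ suc) b)))
    where
    regroup : ∀ x y c → y + (x + c * y) ≡ x + (1 + c) * y
    regroup = ℕSolver.solve-∀

  live-markDead : ∀ (D : Fin k → Bool) b → D b ≡ false → live D ≡ suc (live (markDead D b))
  live-markDead D b Db≡false = begin
    live D                                                      ≡⟨ sum-cong-≗ (λ a → split (D a) (does (a ≟ b))) ⟩
    (∑ λ a → if D a then 0 else if does (a ≟ b) then 1 else 1)  ≡⟨ ∑-live-split D b 1 1 Db≡false ⟩
    1 + live (markDead D b) * 1                                 ≡⟨ cong suc (ℕP.*-identityʳ _) ⟩
    suc (live (markDead D b))                                   ∎
    where
    open ≡-Reasoning
    split : ∀ d e → (if d then 0 else 1) ≡ (if d then 0 else if e then 1 else 1)
    split true  _     = refl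
    split false true  = refl
    split false false = refl

  ∑-live-run : ∀ (D : Fin k → Bool) b x y → D b ≡ false →
    (∑ λ a → if D a then 0 else if does (a ≟ b) then x else y) ≡ x + (live D ∸ 1) * y
  ∑-live-run D b x y b-alive =
    trans (∑-live-split D b x y b-alive) (cong (λ j → x + (j ∸ 1) * y) (sym (live-markDead D b b-alive)))

  ∑-alive-cong : ∀ (D : Fin k → Bool) {f g : Fin k → ℕ} → (∀ a → D a ≡ false → f a ≡ g a) →
    (∑ λ a → if D a then 0 else f a) ≡ (∑ λ a → if D a then 0 else g a)
  ∑-alive-cong D {f} {g} f≡g = sum-cong-≗ pointwise
    where
    pointwise : ∀ a → (if D a then 0 else f a) ≡ (if D a then 0 else g a)
    pointwise a with D a in a-dead
    ... | true  = refl
    ... | false = f≡g a a-dead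

  data Phase : Set where
    idle single double : Phase

  phase : Run k → Phase
  phase idle       = idle
  phase (single _) = single
  phase (double _) = double

  -- The number of avoiding continuations of length n of a prefix with i live letters whose
  -- trailing run is in phase p.
  continuations : ℕ → ℕ → Phase → ℕ
  continuations zero    i _      = 1
  continuations (suc n) i idle   = i * continuations n i single
  continuations (suc n) i single = continuations n i double + (i ∸ 1) * continuations n i single
  continuations (suc n) i double = continuations n (i ∸ 1) idle + (i ∸ 1) * continuations n i single

  RunAlive : State k → Set
  RunAlive (state D idle)       = ⊤
  RunAlive (state D (single b)) = D b ≡ false
  RunAlive (state D (double b)) = D b ≡ false

  accepted≡continuations : ∀ n (s : State k) → RunAlive s →
    accepted n s ≡ continuations n (live (dead s)) (phase (run s))
  accepted≡continuations zero s _ = refl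
  accepted≡continuations (suc n) (state D idle) _ =
    trans (accepted-suc n (state D idle))
          (trans (∑-alive-cong D λ a → accepted≡continuations n (state D (single a))) (∑-live D _))
  accepted≡continuations (suc n) (state D (single b)) b-alive =
    trans (accepted-suc n (state D (single b))) (trans (∑-alive-cong D next) (∑-live-run D b _ _ b-alive))
    where
    i = live D
    next : ∀ a → D a ≡ false → accepted n (step (state D (single b)) a) ≡
                 (if does (a ≟ b) then continuations n i double else continuations n i single)
    next a a-alive with a ≟ b
    ... | yes refl = accepted≡continuations n (state D (double a)) b-alive
    ... | no _     = accepted≡continuations n (state D (single a)) a-alive
  accepted≡continuations (suc n) (state D (double b)) b-alive =
    trans (accepted-suc n (state D (double b))) (trans (∑-alive-cong D next) (∑-live-run D b _ _ b-alive))
    where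
    i = live D
    next : ∀ a → D a ≡ false → accepted n (step (state D (double b)) a) ≡
                 (if does (a ≟ b) then continuations n (i ∸ 1) idle else continuations n i single)
    next a a-alive with a ≟ b
    ... | yes refl = trans (accepted≡continuations n (state (markDead D a) idle) tt)
                           (cong (λ j → continuations n (j ∸ 1) idle) (sym (live-markDead D a b-alive)))
    ... | no _     = accepted≡continuations n (state D (single a)) a-alive

  live-initial : ∀ k → live {k} (λ _ → false) ≡ k
  live-initial zero    = refl
  live-initial (suc k) = cong suc (live-initial k)

  a111-1≡continuations : ∀ n k → a111-1 n k ≡ continuations n k idle
  a111-1≡continuations n k = begin
    a111-1 n k                                           ≡⟨ a111-1≡accepted n k ⟩
    accepted n initial                                   ≡⟨ accepted≡continuations n initial tt ⟩
    continuations n (live {k} (λ _ → false)) idle        ≡⟨ cong (λ i → continuations n i idle) (live-initial k) ⟩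
    continuations n k idle                               ∎
    where open ≡-Reasoning

module GeneratingFunctions where

  open import Data.Integer using (+_; _*_; _-_)
  open PowerSeries
  open SeriesAlgebra
  open Factorials
  open Lists
  open Avoidance using (Phase; idle; single; double; continuations)
  open Relation.Binary.Reasoning.Setoid setoid
  open Solver using (solve; _:=_; _:+_; _:*_; _:-_; _:^_; con)

  gf : Phase → ℕ → PS
  gf p i n = + continuations n i p

  factor : ℕ → PS
  factor i = 1ˢ ⊖ const (+ (i ∸ 1)) ⊛ X ⊛ (1ˢ ⊕ X)

  factor-at-0 : ∀ i → factor i 0 ≡ + 1
  factor-at-0 i = cong (λ z → + 1 - z)
    (trans (⊛-at-0 (const (+ (i ∸ 1)) ⊛ X) (1ˢ ⊕ X))
           (cong (_* + 1) (trans (⊛-at-0 (const (+ (i ∸ 1))) X) (ℤP.*-zeroʳ (+ (i ∸ 1))))))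

  scaled-gf : ∀ c p i n → (const (+ c) ⊛ gf p i) n ≡ + (c Nat.* continuations n i p)
  scaled-gf c p i n = trans (const-⊛ (+ c) (gf p i) n) (sym (ℤP.pos-* c (continuations n i p)))

  idle-equation : ∀ i → gf idle i ≈ 1ˢ ⊕ X ⊛ (const (+ i) ⊛ gf single i)
  idle-equation i = unshift (gf idle i) _ refl λ n → sym (scaled-gf i single i n)

  single-equation : ∀ i → gf single i ≈ 1ˢ ⊕ X ⊛ (gf double i ⊕ const (+ (i ∸ 1)) ⊛ gf single i)
  single-equation i = unshift (gf single i) _ refl λ n →
    trans (ℤP.pos-+ (continuations n i double) _)
          (cong (λ z → gf double i n Int.+ z) (sym (scaled-gf (i ∸ 1) single i n)))

  double-equation : ∀ i → gf double i ≈ 1ˢ ⊕ X ⊛ (gf idle (i ∸ 1) ⊕ const (+ (i ∸ 1)) ⊛ gf single i)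
  double-equation i = unshift (gf double i) _ refl λ n →
    trans (ℤP.pos-+ (continuations n (i ∸ 1) idle) _)
          (cong (λ z → gf idle (i ∸ 1) n Int.+ z) (sym (scaled-gf (i ∸ 1) single i n)))

  factor-⊛-single : ∀ i → factor i ⊛ gf single i ≈ 1ˢ ⊕ X ⊕ X ⊛ (X ⊛ gf idle (i ∸ 1))
  factor-⊛-single i = begin
    factor i ⊛ S
      ≈⟨ solve 3 (λ C Y Q → (con (+ 1) :- C :* Y :* (con (+ 1) :+ Y)) :* Q
                          := Q :- (C :* Y :* Q :+ C :* Y :* Y :* Q)) (λ _ → refl) c X S ⟩
    S ⊕ -ˢ (c ⊛ X ⊛ S ⊕ c ⊛ X ⊛ X ⊛ S)
      ≈⟨ +-congʳ {R} (single-equation i) ⟩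
    1ˢ ⊕ X ⊛ (D ⊕ c ⊛ S) ⊕ -ˢ (c ⊛ X ⊛ S ⊕ c ⊛ X ⊛ X ⊛ S)
      ≈⟨ +-congʳ {R} (+-congˡ {1ˢ} (*-congˡ {X} (+-congʳ {c ⊛ S} (double-equation i)))) ⟩
    1ˢ ⊕ X ⊛ (1ˢ ⊕ X ⊛ (N ⊕ c ⊛ S) ⊕ c ⊛ S) ⊕ -ˢ (c ⊛ X ⊛ S ⊕ c ⊛ X ⊛ X ⊛ S)
      ≈⟨ solve 4 (λ C Y Q M → con (+ 1) :+ Y :* (con (+ 1) :+ Y :* (M :+ C :* Q) :+ C :* Q)
                                :- (C :* Y :* Q :+ C :* Y :* Y :* Q)
                            := con (+ 1) :+ Y :+ Y :* (Y :* M)) (λ _ → refl) c X S N ⟩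
    1ˢ ⊕ X ⊕ X ⊛ (X ⊛ N)
      ∎
    where
    c = const (+ (i ∸ 1))
    S = gf single i
    D = gf double i
    N = gf idle (i ∸ 1)
    R = -ˢ (c ⊛ X ⊛ S ⊕ c ⊛ X ⊛ X ⊛ S)

  single-closed : ∀ i → gf single i ≈ (1ˢ ⊕ X ⊕ X ⊛ (X ⊛ gf idle (i ∸ 1))) ⊛ inv₁ (factor i)
  single-closed i = inv₁-unique (factor i) (gf single i) _ (factor-at-0 i) (factor-⊛-single i)

  -- The common recurrence S (m+1) = growth m ⊛ S m ⊕ fresh (m+1) of both sides of the theorem.
  growth : ℕ → PS
  growth m = const (+ suc m) ⊛ X ^ˢ 3 ⊛ inv₁ (factor (suc m))

  fresh : ℕ → PS
  fresh k = (1ˢ ⊕ X ⊛ (1ˢ ⊕ X)) ⊛ inv₁ (factor k)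

  idle-recurrence : ∀ m → gf idle (suc m) ≈ growth m ⊛ gf idle m ⊕ fresh (suc m)
  idle-recurrence m = begin
    gf idle (suc m)
      ≈⟨ idle-equation (suc m) ⟩
    1ˢ ⊕ X ⊛ (const (+ suc m) ⊛ gf single (suc m))
      ≈⟨ +-cong (≈-sym (inv₁-inverseʳ (factor (suc m)) (factor-at-0 (suc m))))
                (*-congˡ {X} (*-cong (const-+ 1 m) (single-closed (suc m)))) ⟩
    factor (suc m) ⊛ I ⊕ X ⊛ ((1ˢ ⊕ c) ⊛ ((1ˢ ⊕ X ⊕ X ⊛ (X ⊛ N)) ⊛ I))
      ≈⟨ solve 4 (λ C Y M J → (con (+ 1) :- C :* Y :* (con (+ 1) :+ Y)) :* J
                               :+ Y :* ((con (+ 1) :+ C) :* ((con (+ 1) :+ Y :+ Y :* (Y :* M)) :* J))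
                          := (con (+ 1) :+ C) :* Y :^ 3 :* J :* M :+ (con (+ 1) :+ Y :* (con (+ 1) :+ Y)) :* J)
                 (λ _ → refl) c X N I ⟩
    (1ˢ ⊕ c) ⊛ X ^ˢ 3 ⊛ I ⊛ N ⊕ fresh (suc m)
      ≈⟨ +-congʳ {fresh (suc m)} (*-congʳ {N} (*-congʳ {I} (*-congʳ {X ^ˢ 3} (≈-sym (const-+ 1 m))))) ⟩
    growth m ⊛ N ⊕ fresh (suc m)
      ∎
    where
    c = const (+ m)
    N = gf idle m
    I = inv₁ (factor (suc m))

  idle-0 : gf idle 0 ≈ 1ˢ
  idle-0 zero    = refl
  idle-0 (suc n) = refl

  denominator : ℕ → ℕ → PS
  denominator j k = prodˢ (map factor (range j k))

  prodˢ-factors-at-0 : ∀ is → prodˢ (map factor is) 0 ≡ + 1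
  prodˢ-factors-at-0 []       = refl
  prodˢ-factors-at-0 (i ∷ is) = ⊛-at-0≡1 (factor i) (prodˢ (map factor is)) (factor-at-0 i) (prodˢ-factors-at-0 is)

  inv₁-denominator-∷ʳ : ∀ {j m} → j ≤ suc m →
    inv₁ (denominator j (suc m)) ≈ inv₁ (denominator j m) ⊛ inv₁ (factor (suc m))
  inv₁-denominator-∷ʳ {j} {m} j≤1+m = begin
    inv₁ (denominator j (suc m))
      ≈⟨ inv₁-cong _ _ (prodˢ-factors-at-0 (range j (suc m))) split ⟩
    inv₁ (denominator j m ⊛ factor (suc m))
      ≈⟨ inv₁-⊛ _ _ (prodˢ-factors-at-0 (range j m)) (factor-at-0 (suc m)) ⟩
    inv₁ (denominator j m) ⊛ inv₁ (factor (suc m))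
      ∎
    where
    split : denominator j (suc m) ≈ denominator j m ⊛ factor (suc m)
    split n = trans (cong (λ is → prodˢ (map factor is) n) (range-∷ʳ j≤1+m))
                    (trans (cong (λ fs → prodˢ fs n) (LP.map-++ factor (range j m) [ suc m ]))
                           (prodˢ-∷ʳ (map factor (range j m)) (factor (suc m)) n))

  summand-step : ∀ m j → j ≤ m → summand (suc m) j ≈ growth m ⊛ summand m j
  summand-step m j j≤m = begin
    summand (suc m) j
      ≈⟨ *-cong (*-cong (*-congʳ {A} coefficient) power) (inv₁-denominator-∷ʳ (ℕP.m≤n⇒m≤1+n j≤m)) ⟩
    const (+ suc m) ⊛ B ⊛ A ⊛ (X ⊛ (X ⊛ (X ⊛ P))) ⊛ (I ⊛ J)
      ≈⟨ solve 7 (λ K B′ A′ Y P′ I′ J′ → K :* B′ :* A′ :* (Y :* (Y :* (Y :* P′))) :* (I′ :* J′)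
                                     := K :* Y :^ 3 :* J′ :* (B′ :* A′ :* P′ :* I′)) (λ _ → refl)
               (const (+ suc m)) B A X P I J ⟩
    growth m ⊛ summand m j
      ∎
    where
    B = const (+ ((m ∸ j) ! Nat.* (m C j)))
    A = 1ˢ ⊕ X ⊛ (1ˢ ⊕ X) ⊕ const (δ₁ j) ⊛ X ^ˢ 3
    P = X ^ˢ (3 Nat.* (m ∸ j))
    I = inv₁ (denominator j m)
    J = inv₁ (factor (suc m))
    coefficient : const (+ ((suc m ∸ j) ! Nat.* (suc m C j))) ≈ const (+ suc m) ⊛ B
    coefficient n = trans (cong (λ c → const (+ c) n) ([1+m∸j]![1+m]Cj≡[1+m]*[m∸j]!mCj j≤m)) (const-* (suc m) _ n)
    power : X ^ˢ (3 Nat.* (suc m ∸ j)) ≈ X ⊛ (X ⊛ (X ⊛ P))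
    power n = cong (λ e → (X ^ˢ e) n) (trans (cong (3 Nat.*_) (ℕP.+-∸-assoc 1 j≤m)) (ℕP.*-suc 3 (m ∸ j)))

  summand-diagonal : ∀ k → summand k k ≈ (1ˢ ⊕ X ⊛ (1ˢ ⊕ X) ⊕ const (δ₁ k) ⊛ X ^ˢ 3) ⊛ inv₁ (factor k)
  summand-diagonal k = begin
    summand k k
      ≈⟨ *-cong (*-cong (*-congʳ {A} coefficient) power) inverse ⟩
    1ˢ ⊛ A ⊛ 1ˢ ⊛ inv₁ (factor k)
      ≈⟨ solve 2 (λ A′ I → con (+ 1) :* A′ :* con (+ 1) :* I := A′ :* I) (λ _ → refl) A (inv₁ (factor k)) ⟩
    A ⊛ inv₁ (factor k)
      ∎
    where
    A = 1ˢ ⊕ X ⊛ (1ˢ ⊕ X) ⊕ const (δ₁ k) ⊛ X ^ˢ 3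
    coefficient : const (+ ((k ∸ k) ! Nat.* (k C k))) ≈ 1ˢ
    coefficient n = cong (λ c → const (+ c) n) (cong₂ (λ d c → d ! Nat.* c) (ℕP.n∸n≡0 k) (nCn≡1 k))
    power : X ^ˢ (3 Nat.* (k ∸ k)) ≈ 1ˢ
    power n = cong (λ d → (X ^ˢ (3 Nat.* d)) n) (ℕP.n∸n≡0 k)
    inverse : inv₁ (denominator k k) ≈ inv₁ (factor k)
    inverse = inv₁-cong _ _ (prodˢ-factors-at-0 (range k k))
      (λ n → trans (cong (λ is → prodˢ (map factor is) n) (range-diagonal k)) (*-identityʳ (factor k) n))

  RHS-one : RHS 1 ≈ growth 0 ⊛ 1ˢ ⊕ fresh 1
  RHS-one = begin
    summand 1 1 ⊕ 0ˢ
      ≈⟨ +-congʳ {0ˢ} (summand-diagonal 1) ⟩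
    (1ˢ ⊕ X ⊛ (1ˢ ⊕ X) ⊕ 1ˢ ⊛ X ^ˢ 3) ⊛ I ⊕ 0ˢ
      ≈⟨ solve 2 (λ Y J → (con (+ 1) :+ Y :* (con (+ 1) :+ Y) :+ con (+ 1) :* Y :^ 3) :* J :+ con (+ 0)
                        := con (+ 1) :* Y :^ 3 :* J :* con (+ 1) :+ (con (+ 1) :+ Y :* (con (+ 1) :+ Y)) :* J)
                 (λ _ → refl) X I ⟩
    growth 0 ⊛ 1ˢ ⊕ fresh 1
      ∎
    where
    I = inv₁ (factor 1)

  RHS-recurrence : ∀ m → RHS (suc (suc m)) ≈ growth (suc m) ⊛ RHS (suc m) ⊕ fresh (suc (suc m))
  RHS-recurrence m = begin
    sumˢ (map (summand k) (range 1 k))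
      ≡⟨ cong (sumˢ ∘ map (summand k)) (range-∷ʳ {1} {suc m} (s≤s z≤n)) ⟩
    sumˢ (map (summand k) (range 1 (suc m) ∷ʳ k))
      ≡⟨ cong sumˢ (LP.map-++ (summand k) (range 1 (suc m)) [ k ]) ⟩
    sumˢ (map (summand k) (range 1 (suc m)) ∷ʳ summand k k)
      ≈⟨ sumˢ-∷ʳ (map (summand k) (range 1 (suc m))) (summand k k) ⟩
    sumˢ (map (summand k) (range 1 (suc m))) ⊕ summand k k
      ≈⟨ +-cong (sumˢ-map-⊛ (growth (suc m)) (All.map (λ {j} → summand-step (suc m) j) (range-1-bounded (suc m))))
                (summand-diagonal k) ⟩
    growth (suc m) ⊛ RHS (suc m) ⊕ (1ˢ ⊕ X ⊛ (1ˢ ⊕ X) ⊕ 0ˢ ⊛ X ^ˢ 3) ⊛ inv₁ (factor k)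
      ≈⟨ +-congˡ {growth (suc m) ⊛ RHS (suc m)}
           (solve 2 (λ Y J → (con (+ 1) :+ Y :* (con (+ 1) :+ Y) :+ con (+ 0) :* Y :^ 3) :* J
                          := (con (+ 1) :+ Y :* (con (+ 1) :+ Y)) :* J) (λ _ → refl) X (inv₁ (factor k))) ⟩
    growth (suc m) ⊛ RHS (suc m) ⊕ fresh k
      ∎
    where
    k = suc (suc m)

  idle≈RHS : ∀ m → gf idle (suc m) ≈ RHS (suc m)
  idle≈RHS zero = begin
    gf idle 1                         ≈⟨ idle-recurrence 0 ⟩
    growth 0 ⊛ gf idle 0 ⊕ fresh 1    ≈⟨ +-congʳ {fresh 1} (*-congˡ {growth 0} idle-0) ⟩
    growth 0 ⊛ 1ˢ ⊕ fresh 1           ≈⟨ RHS-one ⟨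
    RHS 1                             ∎
  idle≈RHS (suc m) = begin
    gf idle (suc (suc m))
      ≈⟨ idle-recurrence (suc m) ⟩
    growth (suc m) ⊛ gf idle (suc m) ⊕ fresh (suc (suc m))
      ≈⟨ +-congʳ {fresh (suc (suc m))} (*-congˡ {growth (suc m)} (idle≈RHS m)) ⟩
    growth (suc m) ⊛ RHS (suc m) ⊕ fresh (suc (suc m))
      ≈⟨ RHS-recurrence m ⟨
    RHS (suc (suc m))
      ∎

open Avoidance using (idle; a111-1≡continuations)
open GeneratingFunctions using (gf; idle≈RHS)

theorem4p2 : (k : ℕ) → 1 ≤ k → (n : ℕ) → W111-1 k n ≡ RHS k n
theorem4p2 (suc m) _ n = begin
  W111-1 (suc m) n     ≡⟨ cong Int.+_ (a111-1≡continuations n (suc m)) ⟩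
  gf idle (suc m) n    ≡⟨ idle≈RHS m n ⟩
  RHS (suc m) n        ∎
  where open ≡-Reasoning
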